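{- Let $n\ge 1$ and $m\ge 2$ be integers, and let $G$ be a finite region-connected $n$-simplex graph with chromatic number $\chi(G)=n+1$. Let $v=|V(G)|$ and let $r$ be the number of $n$-simplexes of $G$; let $R(G)$ denote the set of $n$-simplexes of $G$. Let $L_1,L_2:V(G)\to\mathbb{Z}_m$ be labelings. Call a function $k:R(G)\to\{0,1,\dots,m-1\}$ a solution if applying, for every $S\in R(G)$, the push $f_S$ exactly $k(S)$ times (in any order) transforms $L_1$ into $L_2$. If at least one solution exists, then the number of solutions is exactly $m^{\,r-v+n}$.
   Context: All graphs are finite simple graphs. An $n$-simplex of a graph $G$ is a set of $n+1$ vertices of $G$ that are pairwise adjacent. $G$ is an $n$-simplex graph if $G$ is a union of complete subgraphs on $n+1$ vertices (every vertex and every edge of $G$ lies in some $n$-simplex of $G$). Two $n$-simplexes $S,S'$ are adjacent if $|S\cap S'|=n$; $G$ is region-connected if for any two $n$-simplexes $S,S'$ there is a sequence $S=S_1,S_2,\dots,S_t=S'$ of $n$-simplexes with $S_j$ adjacent to $S_{j+1}$ for all $j$. A labeling is a map $L:V(G)\to\mathbb{Z}_m$. For an $n$-simplex $S$, the push $f_S$ sends a labeling $L$ to the labeling $L'$ with $L'(v)=L(v)+1 \pmod m$ for $v\in S$ and $L'(v)=L(v)$ for $v\notin S$. Pushes commute with one another and applying $f_S$ $m$ times is the identity. -}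

module Defs where

open import Data.Nat using (ℕ; zero; suc; NonZero)
open import Data.Nat.DivMod using (_mod_)
open import Data.Fin using (Fin; toℕ)
open import Data.Fin.Subset using (Subset; _∈_; _∩_; ∣_∣; inside; outside)
open import Data.Fin.Subset.Properties using (_∈?_)
open import Data.Fin.Properties using (all?)
open import Data.Bool using (Bool; if_then_else_)
open import Data.Nat.Properties using (_≟_)
open import Data.Fin.Properties using () renaming (_≟_ to _≟ᶠ_)
open import Data.List using (List; []; _∷_; _++_; map; filter; length)
open import Data.Vec using (Vec; []; _∷_; zipWith)
open import Data.Product using (Σ; ∃; _×_; _,_)
open import Relation.Nullary using (¬_; Dec; _×-dec_; _→-dec_)
open import Relation.Binary using (Decidable)
open import Relation.Binary.PropositionalEquality using (_≡_; _≢_)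
open import Relation.Binary.Construct.Closure.ReflexiveTransitive using (Star)

record Graph (v : ℕ) : Set₁ where
  field
    Adj    : Fin v → Fin v → Set
    adj?   : Decidable Adj
    sym    : ∀ {x y} → Adj x y → Adj y x
    irrefl : ∀ {x} → ¬ Adj x x

module _ {v : ℕ} (G : Graph v) where
  open Graph G

  IsSimplex : ℕ → Subset v → Set
  IsSimplex n S = (∣ S ∣ ≡ suc n) ×
    (∀ x y → x ∈ S → y ∈ S → x ≢ y → Adj x y)

  isSimplex? : ∀ n S → Dec (IsSimplex n S)
  isSimplex? n S = (∣ S ∣ ≟ suc n) ×-dec
    all? (λ x → all? (λ y → (x ∈? S) →-dec ((y ∈? S) →-dec
      ((¬? (x ≟ᶠ y)) →-dec adj? x y))))
    where
    open import Relation.Nullary using (¬?)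

  IsSimplexGraph : ℕ → Set
  IsSimplexGraph n =
    (∀ x → ∃ λ S → IsSimplex n S × x ∈ S) ×
    (∀ x y → Adj x y → ∃ λ S → IsSimplex n S × x ∈ S × y ∈ S)

  AdjSimplex : ℕ → Subset v → Subset v → Set
  AdjSimplex n S S' = IsSimplex n S × IsSimplex n S' × (∣ S ∩ S' ∣ ≡ n)

  RegionConnected : ℕ → Set
  RegionConnected n = ∀ S S' → IsSimplex n S → IsSimplex n S' →
    Star (AdjSimplex n) S S'

  Colourable : ℕ → Set
  Colourable k = Σ (Fin v → Fin k) λ c → ∀ x y → Adj x y → c x ≢ c y

  ChromaticNumber : ℕ → Set
  ChromaticNumber zero    = Colourable zero
  ChromaticNumber (suc k) = Colourable (suc k) × ¬ Colourable k

allSubsets : (v : ℕ) → List (Subset v)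
allSubsets zero    = [] ∷ []
allSubsets (suc v) = map (inside ∷_) (allSubsets v) ++ map (outside ∷_) (allSubsets v)

-- R(G): the list of all n-simplexes of G (each listed exactly once)
simplexes : ∀ {v} → Graph v → ℕ → List (Subset v)
simplexes {v} G n = filter (isSimplex? G n) (allSubsets v)

Labeling : ℕ → ℕ → Set
Labeling v m = Vec (Fin m) v

inc : ∀ {m} .{{_ : NonZero m}} → Fin m → Fin m
inc {m} i = suc (toℕ i) mod m

push : ∀ {v m} .{{_ : NonZero m}} → Subset v → Labeling v m → Labeling v m
push S L = zipWith (λ b l → if b then inc l else l) S L

iter : ∀ {A : Set} → (A → A) → ℕ → A → A
iter f zero    a = a
iter f (suc k) a = f (iter f k a)

applyPushes : ∀ {v m} .{{_ : NonZero m}} → (Ss : List (Subset v)) →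
  Vec (Fin m) (length Ss) → Labeling v m → Labeling v m
applyPushes []       []       L = L
applyPushes (S ∷ Ss) (k ∷ ks) L = iter (push S) (toℕ k) (applyPushes Ss ks L)

Solution : ∀ {v} → Graph v → (n m : ℕ) .{{_ : NonZero m}} →
  Labeling v m → Labeling v m → Set
Solution G n m L₁ L₂ =
  Σ (Vec (Fin m) (length (simplexes G n))) λ k →
    applyPushes (simplexes G n) k L₁ ≡ L₂

-- Pushing with coefficients k adds φ(k) = Σ_S k(S)·1_S to a labeling, so the solutions form a
-- coset of ker φ and it suffices to count ker φ. Fix a proper colouring with n+1 colours. An
-- n-simplex has exactly one vertex of each colour, so every φ(k) is balanced: all colour classes
-- carry the same label sum. Conversely every balanced labeling is some φ(k): two adjacent
-- simplexes differ in one pair of equally coloured vertices, so along a chain of adjacent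
-- simplexes (region-connectedness) the label of any vertex can be moved onto the vertex of the
-- same colour in a fixed simplex S₀, and a balanced labeling carried by S₀ is a multiple of 1_{S₀}.
-- The balanced labelings are the kernel of the surjection ℤₘ^v → ℤₘ^n sending a labeling to the
-- differences of its colour sums, hence |im φ| = m^(v-n) and |ker φ| = m^r / m^(v-n).

module Submission where

open import Defs

open import Algebra.Bundles using (Monoid; Group; AbelianGroup)
open import Algebra.Core using (Op₁; Op₂)
import Algebra.Properties.AbelianGroup
import Algebra.Properties.CommutativeMonoid.Sum
import Algebra.Properties.CommutativeSemigroup
import Algebra.Properties.Group
import Algebra.Properties.Monoid.Sum
open import Algebra.Structures using (IsGroup; IsAbelianGroup)
open import Axiom.UniquenessOfIdentityProofs.WithK using (uip)
open import Data.Bool using (Bool; true; false; if_then_else_)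
open import Data.Bool.Properties using (¬-not)
open import Data.Empty using (⊥-elim)
open import Data.Fin using (Fin; zero; suc; toℕ; _≟_)
open import Data.Fin.Permutation using (↔⇒≡)
open import Data.Fin.Properties
  using (toℕ-fromℕ<; toℕ-injective; toℕ<n; suc-injective; +↔⊎; *↔×; any?; nonZeroIndex)
open import Data.Fin.Subset using (Subset; _∈_; _∉_; _⊆_; _∩_; _─_; ⁅_⁆; ⊤; ∣_∣; inside; outside)
  renaming (_-_ to _∖_)
open import Data.Fin.Subset.Properties
  using (_∈?_; drop-there; x∈p∧x≢y⇒x∈p-y; x∈p⇒∣p-x∣<∣p∣; p⊆q⇒∣p∣≤∣q∣; x∈p∩q⁻; x∈p∧x∉q⇒x∈p─q;
         ⊆-antisym; x∈⁅x⁆; x∈⁅y⁆⇒x≡y; ∈⊤; ∣⊤∣≡n; ∩-comm)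
open import Data.List using (List; []; _∷_; length)
import Data.List as List
open import Data.List.Membership.Propositional using () renaming (_∈_ to _∈ˡ_)
open import Data.List.Membership.Propositional.Properties using (∈-map⁺; ∈-++⁺ˡ; ∈-++⁺ʳ; ∈-filter⁺)
open import Data.List.Relation.Unary.All using (All; []; _∷_)
open import Data.List.Relation.Unary.All.Properties using (all-filter)
open import Data.List.Relation.Unary.Any using (here; there)
open import Data.Nat using (ℕ; zero; suc; z≤n; s≤s; _+_; _∸_; _*_; _^_; _≤_; _<_; _≤?_; NonZero)
open import Data.Nat.DivMod using (_mod_; _%_; %-distribˡ-+; m<n⇒m%n≡m; n%n≡0; m*n%n≡0)
import Data.Nat.Properties as ℕ
open import Data.Product using (Σ; _×_; _,_; proj₁; proj₂)
import Data.Product as Product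
open import Data.Product.Function.Dependent.Propositional using (Σ-↔)
open import Data.Product.Function.NonDependent.Propositional using (_×-↔_)
open import Data.Product.Properties using (Σ-≡,≡→≡)
open import Data.Sum using (_⊎_; inj₁; inj₂)
open import Data.Sum.Function.Propositional using (_⊎-↔_)
import Data.Unit as Unit
open import Data.Vec using (Vec; []; _∷_; here; there; zipWith; replicate; map; lookup; tabulate)
open import Data.Vec.Functional using (Vector)
open import Data.Vec.Properties
  using (≡-dec; []=⇒lookup; lookup⇒[]=; lookup∘tabulate; lookup-map; lookup-zipWith; lookup-replicate;
         map-cong; map-const; zipWith-assoc; zipWith-comm; zipWith-identityˡ; zipWith-identityʳ;
         zipWith-inverseˡ; zipWith-inverseʳ)
open import Data.Vec.Recursive using (Fin[m^n]↔Fin[m]^n)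
open import Data.Vec.Recursive.Properties using (↔Vec)
open import Data.Vec.Relation.Binary.Pointwise.Extensional using (ext; Pointwise-≡⇒≡)
open import Function using (_∘_; case_of_)
open import Function.Bundles using (_↔_; mk↔ₛ′; Inverse)
open import Function.Properties.Inverse using (↔-refl; ↔-trans; ↔-sym)
import Function.Related.Propositional as Related
open import Level using (0ℓ)
open import Relation.Binary.Construct.Closure.ReflexiveTransitive using (Star; _◅_)
import Relation.Binary.Construct.Closure.ReflexiveTransitive as Star
open import Relation.Binary.PropositionalEquality
  using (_≡_; _≢_; refl; sym; trans; cong; cong₂; subst; isEquivalence; module ≡-Reasoning)
open import Relation.Nullary using (¬_; Irrelevant; Dec; yes; no; does; _×-dec_)
open import Relation.Nullary.Decidable using (dec-true)
open import Relation.Unary using (Decidable)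

-- Abelian groups

module _ {A : Set} {_∙_ : Op₂ A} {ε : A} {_⁻¹ : Op₁ A} (G : IsAbelianGroup _≡_ _∙_ ε _⁻¹) where
  open IsAbelianGroup G using (assoc; identityˡ; identityʳ; inverseˡ; inverseʳ; comm)

  zipWith-isAbelianGroup : ∀ n → IsAbelianGroup _≡_ (zipWith {n = n} _∙_) (replicate n ε) (map _⁻¹)
  zipWith-isAbelianGroup n = record
    { isGroup = record
      { isMonoid = record
        { isSemigroup = record
          { isMagma = record { isEquivalence = isEquivalence ; ∙-cong = cong₂ (zipWith _∙_) }
          ; assoc = zipWith-assoc assoc
          }
        ; identity = zipWith-identityˡ identityˡ , zipWith-identityʳ identityʳ
        }
      ; inverse = zipWith-inverseˡ inverseˡ , zipWith-inverseʳ inverseʳ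
      ; ⁻¹-cong = cong (map _⁻¹)
      }
    ; comm = zipWith-comm comm
    }

module AbelianGroupIdentities {a ℓ} (G : AbelianGroup a ℓ) where
  open AbelianGroup G
    using (_≈_; _∙_; _⁻¹; _-_; ε; setoid; commutativeSemigroup; assoc; identityʳ; inverseʳ; ∙-congˡ)
  open import Algebra.Properties.AbelianGroup G
  open import Algebra.Properties.CommutativeSemigroup commutativeSemigroup using (interchange)
  open import Relation.Binary.Reasoning.Setoid setoid

  -‿interchange : ∀ x y u w → (x ∙ y) - (u ∙ w) ≈ (x - u) ∙ (y - w)
  -‿interchange x y u w = begin
    (x ∙ y) ∙ (u ∙ w) ⁻¹       ≈⟨ ∙-congˡ (⁻¹-∙-comm u w) ⟨
    (x ∙ y) ∙ (u ⁻¹ ∙ w ⁻¹)    ≈⟨ interchange x y (u ⁻¹) (w ⁻¹) ⟩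
    (x - u) ∙ (y - w)          ∎

  -‿cancelʳ : ∀ x y z → (x ∙ z) - (y ∙ z) ≈ x - y
  -‿cancelʳ x y z = begin
    (x ∙ z) - (y ∙ z)   ≈⟨ -‿interchange x z y z ⟩
    (x - y) ∙ (z - z)   ≈⟨ ∙-congˡ (inverseʳ z) ⟩
    (x - y) ∙ ε         ≈⟨ identityʳ (x - y) ⟩
    x - y               ∎

  -‿telescope : ∀ x y z → (x - y) ∙ (y - z) ≈ x - z
  -‿telescope x y z = begin
    (x - y) ∙ (y - z)      ≈⟨ assoc x (y ⁻¹) (y - z) ⟩
    x ∙ (y ⁻¹ ∙ (y - z))   ≈⟨ ∙-congˡ (\\-leftDividesʳ y (z ⁻¹)) ⟩
    x - z                  ∎

module _ {a ℓ} (M : Monoid a ℓ) where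
  open Monoid M using (Carrier; _≈_; _∙_; ε; setoid; ∙-cong; ∙-congˡ; identityˡ; identityʳ)
  open import Algebra.Properties.Monoid.Sum M using (sum; sum-cong-≋; sum-replicate-zero)
  open import Relation.Binary.Reasoning.Setoid setoid

  sum-vanishing : ∀ {k} (f : Vector Carrier k) → (∀ x → f x ≈ ε) → sum f ≈ ε
  sum-vanishing {k} f f≈ε = begin
    sum f                ≈⟨ sum-cong-≋ f≈ε ⟩
    sum {k} (λ _ → ε)    ≈⟨ sum-replicate-zero k ⟩
    ε                    ∎

  sum-supported : ∀ {k} (f : Vector Carrier k) (z : Fin k) → (∀ x → x ≢ z → f x ≈ ε) → sum f ≈ f z
  sum-supported f zero f≈ε = begin
    f zero ∙ sum (f ∘ suc)   ≈⟨ ∙-congˡ (sum-vanishing (f ∘ suc) (λ x → f≈ε (suc x) λ ())) ⟩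
    f zero ∙ ε               ≈⟨ identityʳ (f zero) ⟩
    f zero                   ∎
  sum-supported f (suc z) f≈ε = begin
    f zero ∙ sum (f ∘ suc)
      ≈⟨ ∙-cong (f≈ε zero λ ()) (sum-supported (f ∘ suc) z λ x x≢z → f≈ε (suc x) (x≢z ∘ suc-injective)) ⟩
    ε ∙ f (suc z)            ≈⟨ identityˡ (f (suc z)) ⟩
    f (suc z)                ∎

module _ {a b ℓ₁ ℓ₂} (M : Monoid a ℓ₁) (N : Monoid b ℓ₂) where
  private
    module M = Monoid M
    module N = Monoid N
    module ∑ᴹ = Algebra.Properties.Monoid.Sum M
    module ∑ᴺ = Algebra.Properties.Monoid.Sum N
  open import Relation.Binary.Reasoning.Setoid N.setoid

  sum-homo : (h : M.Carrier → N.Carrier) → (∀ x y → h (x M.∙ y) N.≈ h x N.∙ h y) → h M.ε N.≈ N.ε →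
    ∀ {k} (f : Vector M.Carrier k) → h (∑ᴹ.sum f) N.≈ ∑ᴺ.sum (h ∘ f)
  sum-homo h ∙-homo ε-homo {zero} f = ε-homo
  sum-homo h ∙-homo ε-homo {suc k} f = begin
    h (f zero M.∙ ∑ᴹ.sum (f ∘ suc))       ≈⟨ ∙-homo (f zero) (∑ᴹ.sum (f ∘ suc)) ⟩
    h (f zero) N.∙ h (∑ᴹ.sum (f ∘ suc))   ≈⟨ N.∙-congˡ (sum-homo h ∙-homo ε-homo (f ∘ suc)) ⟩
    h (f zero) N.∙ ∑ᴺ.sum (h ∘ f ∘ suc)   ∎

Σ-≡-irrelevant : ∀ {A : Set} {P : A → Set} → (∀ x → Irrelevant (P x)) →
  ∀ {a b} {p : P a} {q : P b} → a ≡ b → (a , p) ≡ (b , q)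
Σ-≡-irrelevant P-irr {a} a≡b = Σ-≡,≡→≡ (a≡b , P-irr _ _ _)

Irrelevant-⇔⇒↔ : ∀ {P Q : Set} → Irrelevant P → Irrelevant Q → (P → Q) → (Q → P) → P ↔ Q
Irrelevant-⇔⇒↔ P-irr Q-irr to from = mk↔ₛ′ to from (λ _ → Q-irr _ _) (λ _ → P-irr _ _)

module GroupHomomorphism
  {A B : Set} {_∙ᴬ_ : Op₂ A} {εᴬ : A} {_⁻¹ᴬ : Op₁ A} {_∙ᴮ_ : Op₂ B} {εᴮ : B} {_⁻¹ᴮ : Op₁ B}
  (isGroupᴬ : IsGroup _≡_ _∙ᴬ_ εᴬ _⁻¹ᴬ) (isGroupᴮ : IsGroup _≡_ _∙ᴮ_ εᴮ _⁻¹ᴮ)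
  (h : A → B) (h-homo : ∀ x y → h (x ∙ᴬ y) ≡ h x ∙ᴮ h y) where

  private
    groupᴬ groupᴮ : Group 0ℓ 0ℓ
    groupᴬ = record { isGroup = isGroupᴬ }
    groupᴮ = record { isGroup = isGroupᴮ }
    module 𝔸 = Algebra.Properties.Group groupᴬ
    module 𝔹 = Algebra.Properties.Group groupᴮ
  open ≡-Reasoning

  h-identity : h εᴬ ≡ εᴮ
  h-identity = 𝔹.identityˡ-unique (h εᴬ) (h εᴬ) (begin
    h εᴬ ∙ᴮ h εᴬ   ≡⟨ h-homo εᴬ εᴬ ⟨
    h (εᴬ ∙ᴬ εᴬ)   ≡⟨ cong h (IsGroup.identityˡ isGroupᴬ εᴬ) ⟩
    h εᴬ           ∎)

  h-inverse : ∀ x → h (x ⁻¹ᴬ) ≡ h x ⁻¹ᴮ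
  h-inverse x = 𝔹.inverseʳ-unique (h x) (h (x ⁻¹ᴬ)) (begin
    h x ∙ᴮ h (x ⁻¹ᴬ)   ≡⟨ h-homo x (x ⁻¹ᴬ) ⟨
    h (x ∙ᴬ (x ⁻¹ᴬ))   ≡⟨ cong h (IsGroup.inverseʳ isGroupᴬ x) ⟩
    h εᴬ               ≡⟨ h-identity ⟩
    εᴮ                 ∎)

  h-homo-/ : ∀ x y → h (x ∙ᴬ (y ⁻¹ᴬ)) ≡ h x ∙ᴮ (h y ⁻¹ᴮ)
  h-homo-/ x y = trans (h-homo x (y ⁻¹ᴬ)) (cong (h x ∙ᴮ_) (h-inverse y))

  Kernel : Set
  Kernel = Σ A λ x → h x ≡ εᴮ

  fibre↔Kernel : ∀ {y} x₀ → h x₀ ≡ y → Σ A (λ x → h x ≡ y) ↔ Kernel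
  fibre↔Kernel {y} x₀ hx₀≡y = mk↔ₛ′ to from
    (λ (z , _) → Σ-≡-irrelevant (λ _ → uip) (𝔸.//-rightDividesʳ x₀ z))
    (λ (x , _) → Σ-≡-irrelevant (λ _ → uip) (𝔸.//-rightDividesˡ x₀ x))
    where
    to : Σ A (λ x → h x ≡ y) → Kernel
    to (x , hx≡y) = x ∙ᴬ (x₀ ⁻¹ᴬ) , (begin
      h (x ∙ᴬ (x₀ ⁻¹ᴬ))    ≡⟨ h-homo-/ x x₀ ⟩
      h x ∙ᴮ (h x₀ ⁻¹ᴮ)    ≡⟨ cong₂ (λ u w → u ∙ᴮ (w ⁻¹ᴮ)) hx≡y hx₀≡y ⟩
      y ∙ᴮ (y ⁻¹ᴮ)         ≡⟨ IsGroup.inverseʳ isGroupᴮ y ⟩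
      εᴮ                   ∎)
    from : Kernel → Σ A (λ x → h x ≡ y)
    from (z , hz≡ε) = z ∙ᴬ x₀ , (begin
      h (z ∙ᴬ x₀)     ≡⟨ h-homo z x₀ ⟩
      h z ∙ᴮ h x₀     ≡⟨ cong₂ _∙ᴮ_ hz≡ε hx₀≡y ⟩
      εᴮ ∙ᴮ y         ≡⟨ IsGroup.identityˡ isGroupᴮ y ⟩
      y               ∎)

  ↔Kernel×image : (I : B → Set) → (∀ y → Irrelevant (I y)) → (∀ x → I (h x)) →
    (∀ y → I y → Σ A λ x → h x ≡ y) → A ↔ (Kernel × Σ B I)
  ↔Kernel×image I I-irr I-image section = mk↔ₛ′ to from to∘from from∘to
    where
    lift : ∀ y → I y → A
    lift y p = proj₁ (section y p)
    lift-cong : ∀ {y y'} → y ≡ y' → (p : I y) (p' : I y') → lift y p ≡ lift y' p'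
    lift-cong refl p p' = cong (lift _) (I-irr _ p p')
    to : A → Kernel × Σ B I
    to x = (x ∙ᴬ (lift (h x) (I-image x) ⁻¹ᴬ) , (begin
      h (x ∙ᴬ (lift (h x) (I-image x) ⁻¹ᴬ))  ≡⟨ h-homo-/ x _ ⟩
      h x ∙ᴮ (h (lift (h x) _) ⁻¹ᴮ)          ≡⟨ cong (λ u → h x ∙ᴮ (u ⁻¹ᴮ)) (proj₂ (section (h x) _)) ⟩
      h x ∙ᴮ (h x ⁻¹ᴮ)                       ≡⟨ IsGroup.inverseʳ isGroupᴮ (h x) ⟩
      εᴮ                                     ∎)) , (h x , I-image x)
    from : Kernel × Σ B I → A
    from ((z , _) , (y , p)) = z ∙ᴬ lift y p
    h-from : ∀ z y p → h z ≡ εᴮ → h (z ∙ᴬ lift y p) ≡ y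
    h-from z y p hz≡ε = begin
      h (z ∙ᴬ lift y p)       ≡⟨ h-homo z (lift y p) ⟩
      h z ∙ᴮ h (lift y p)     ≡⟨ cong₂ _∙ᴮ_ hz≡ε (proj₂ (section y p)) ⟩
      εᴮ ∙ᴮ y                 ≡⟨ IsGroup.identityˡ isGroupᴮ y ⟩
      y                       ∎
    to∘from : ∀ w → to (from w) ≡ w
    to∘from ((z , hz≡ε) , (y , p)) = cong₂ _,_
      (Σ-≡-irrelevant (λ _ → uip) (begin
        (z ∙ᴬ lift y p) ∙ᴬ (lift (h (z ∙ᴬ lift y p)) _ ⁻¹ᴬ)
          ≡⟨ cong (λ u → (z ∙ᴬ lift y p) ∙ᴬ (u ⁻¹ᴬ)) (lift-cong (h-from z y p hz≡ε) _ p) ⟩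
        (z ∙ᴬ lift y p) ∙ᴬ (lift y p ⁻¹ᴬ)
          ≡⟨ 𝔸.//-rightDividesʳ (lift y p) z ⟩
        z ∎))
      (Σ-≡-irrelevant I-irr (h-from z y p hz≡ε))
    from∘to : ∀ x → from (to x) ≡ x
    from∘to x = 𝔸.//-rightDividesˡ (lift (h x) (I-image x)) x

-- Counting

Dec↔Fin : ∀ {P : Set} → Irrelevant P → (P? : Dec P) → P ↔ Fin (if does P? then 1 else 0)
Dec↔Fin P-irr (yes p) = Irrelevant-⇔⇒↔ P-irr Fin1-irrelevant (λ _ → zero) (λ _ → p)
  where
  Fin1-irrelevant : Irrelevant (Fin 1)
  Fin1-irrelevant zero zero = refl
Dec↔Fin P-irr (no ¬p) = mk↔ₛ′ (⊥-elim ∘ ¬p) (λ ()) (λ ()) (⊥-elim ∘ ¬p)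

count : ∀ {N} {P : Fin N → Set} → Decidable P → ℕ
count {zero}  P? = 0
count {suc N} P? = (if does (P? zero) then 1 else 0) + count (P? ∘ suc)

Σ-Fin-suc↔ : ∀ {N} (P : Fin (suc N) → Set) → Σ (Fin (suc N)) P ↔ (P zero ⊎ Σ (Fin N) (P ∘ suc))
Σ-Fin-suc↔ P = mk↔ₛ′ to from to∘from from∘to
  where
  to : Σ (Fin _) P → P zero ⊎ Σ (Fin _) (P ∘ suc)
  to (zero , p)  = inj₁ p
  to (suc x , p) = inj₂ (x , p)
  from : P zero ⊎ Σ (Fin _) (P ∘ suc) → Σ (Fin _) P
  from (inj₁ p)       = zero , p
  from (inj₂ (x , p)) = suc x , p
  to∘from : ∀ w → to (from w) ≡ w
  to∘from (inj₁ _) = refl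
  to∘from (inj₂ _) = refl
  from∘to : ∀ w → from (to w) ≡ w
  from∘to (zero , _)  = refl
  from∘to (suc _ , _) = refl

Σ↔Fin-count : ∀ {N} {P : Fin N → Set} → (∀ x → Irrelevant (P x)) → (P? : Decidable P) →
  Σ (Fin N) P ↔ Fin (count P?)
Σ↔Fin-count {zero} P-irr P? = mk↔ₛ′ (λ ()) (λ ()) (λ ()) (λ ())
Σ↔Fin-count {suc N} {P} P-irr P? = begin
  Σ (Fin (suc N)) P                 ↔⟨ Σ-Fin-suc↔ P ⟩
  (P zero ⊎ Σ (Fin N) (P ∘ suc))
    ↔⟨ Dec↔Fin (P-irr zero) (P? zero) ⊎-↔ Σ↔Fin-count (P-irr ∘ suc) (P? ∘ suc) ⟩
  (Fin _ ⊎ Fin (count (P? ∘ suc)))  ↔⟨ +↔⊎ ⟨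
  Fin (count P?)                    ∎
  where open Related.EquationalReasoning

Σ-finite : ∀ {A : Set} {N} {P : A → Set} → A ↔ Fin N → (∀ x → Irrelevant (P x)) → Decidable P →
  Σ ℕ λ c → Σ A P ↔ Fin c
Σ-finite {A} {N} {P} A↔Fin P-irr P? = count (P? ∘ from) , (begin
  Σ A P
    ↔⟨ Σ-↔ A↔Fin (Irrelevant-⇔⇒↔ (P-irr _) (P-irr _)
         (subst P (sym (strictlyInverseʳ _))) (subst P (strictlyInverseʳ _))) ⟩
  Σ (Fin N) (P ∘ from)   ↔⟨ Σ↔Fin-count (P-irr ∘ from) (P? ∘ from) ⟩
  Fin _                  ∎)
  where
  open Inverse A↔Fin using (from; strictlyInverseʳ)
  open Related.EquationalReasoning

Vec↔Fin^ : ∀ m n → Vec (Fin m) n ↔ Fin (m ^ n)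
Vec↔Fin^ m n = ↔-trans (↔-sym (↔Vec n)) (↔-sym (Fin[m^n]↔Fin[m]^n m n))

-- Without 1 < m, v > r + n could not be excluded and the truncated r + n ∸ v would be wrong.
^-cancel : ∀ {m r v n κ w} → 1 < m → NonZero κ → m ^ r ≡ κ * w → m ^ v ≡ w * m ^ n →
  κ ≡ m ^ (r + n ∸ v)
^-cancel {m@(suc _)} {r} {v} {n} {κ} {w} 1<m κ≢0 m^r≡κw m^v≡wm^n = cancel (v ≤? r + n)
  where
  open ≡-Reasoning
  κm^v≡m^[r+n] : κ * m ^ v ≡ m ^ (r + n)
  κm^v≡m^[r+n] = begin
    κ * m ^ v          ≡⟨ cong (κ *_) m^v≡wm^n ⟩
    κ * (w * m ^ n)    ≡⟨ ℕ.*-assoc κ w (m ^ n) ⟨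
    κ * w * m ^ n      ≡⟨ cong (_* m ^ n) m^r≡κw ⟨
    m ^ r * m ^ n      ≡⟨ ℕ.^-distribˡ-+-* m r n ⟨
    m ^ (r + n)        ∎
  cancel : Dec (v ≤ r + n) → κ ≡ m ^ (r + n ∸ v)
  cancel (yes v≤r+n) = ℕ.*-cancelʳ-≡ κ (m ^ (r + n ∸ v)) (m ^ v) {{ℕ.m^n≢0 m v}} (begin
    κ * m ^ v                ≡⟨ κm^v≡m^[r+n] ⟩
    m ^ (r + n)              ≡⟨ cong (m ^_) (ℕ.m∸n+n≡m v≤r+n) ⟨
    m ^ (r + n ∸ v + v)      ≡⟨ ℕ.^-distribˡ-+-* m (r + n ∸ v) v ⟩
    m ^ (r + n ∸ v) * m ^ v  ∎)
  cancel (no v≰r+n) = ⊥-elim (ℕ.<-irrefl refl (ℕ.<-≤-trans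
    (ℕ.^-monoʳ-< m 1<m (ℕ.≰⇒> v≰r+n))
    (ℕ.≤-trans (ℕ.m≤n*m (m ^ v) κ {{κ≢0}}) (ℕ.≤-reflexive κm^v≡m^[r+n]))))

-- Labels in ℤₘ

module _ {m : ℕ} .{{_ : NonZero m}} where

  ⟦_⟧ : ℕ → Fin m
  ⟦ x ⟧ = x mod m

  0ₘ : Fin m
  0ₘ = ⟦ 0 ⟧

  infixl 6 _+ₘ_
  _+ₘ_ : Op₂ (Fin m)
  a +ₘ b = ⟦ toℕ a + toℕ b ⟧

  -ₘ_ : Op₁ (Fin m)
  -ₘ a = ⟦ m ∸ toℕ a ⟧

  toℕ-⟦⟧ : ∀ x → toℕ ⟦ x ⟧ ≡ x % m
  toℕ-⟦⟧ x = toℕ-fromℕ< _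

  ⟦⟧-cong-% : ∀ {x y} → x % m ≡ y % m → ⟦ x ⟧ ≡ ⟦ y ⟧
  ⟦⟧-cong-% {x} {y} eq = toℕ-injective (trans (toℕ-⟦⟧ x) (trans eq (sym (toℕ-⟦⟧ y))))

  ⟦toℕ⟧ : (a : Fin m) → ⟦ toℕ a ⟧ ≡ a
  ⟦toℕ⟧ a = toℕ-injective (trans (toℕ-⟦⟧ (toℕ a)) (m<n⇒m%n≡m (toℕ<n a)))

  ⟦⟧-homo : ∀ x y → ⟦ x + y ⟧ ≡ ⟦ x ⟧ +ₘ ⟦ y ⟧
  ⟦⟧-homo x y = ⟦⟧-cong-% (trans (%-distribˡ-+ x y m)
    (sym (cong₂ (λ p q → (p + q) % m) (toℕ-⟦⟧ x) (toℕ-⟦⟧ y))))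

  ⟦m⟧≡0ₘ : ⟦ m ⟧ ≡ 0ₘ
  ⟦m⟧≡0ₘ = ⟦⟧-cong-% (trans (n%n≡0 m) (sym (m*n%n≡0 0 m)))

  +ₘ-comm : ∀ a b → a +ₘ b ≡ b +ₘ a
  +ₘ-comm a b = cong ⟦_⟧ (ℕ.+-comm (toℕ a) (toℕ b))

  +ₘ-assoc : ∀ a b c → (a +ₘ b) +ₘ c ≡ a +ₘ (b +ₘ c)
  +ₘ-assoc a b c = begin
    (a +ₘ b) +ₘ c                     ≡⟨ cong ((a +ₘ b) +ₘ_) (⟦toℕ⟧ c) ⟨
    ⟦ toℕ a + toℕ b ⟧ +ₘ ⟦ toℕ c ⟧    ≡⟨ ⟦⟧-homo (toℕ a + toℕ b) (toℕ c) ⟨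
    ⟦ toℕ a + toℕ b + toℕ c ⟧         ≡⟨ cong ⟦_⟧ (ℕ.+-assoc (toℕ a) (toℕ b) (toℕ c)) ⟩
    ⟦ toℕ a + (toℕ b + toℕ c) ⟧       ≡⟨ ⟦⟧-homo (toℕ a) (toℕ b + toℕ c) ⟩
    ⟦ toℕ a ⟧ +ₘ (b +ₘ c)             ≡⟨ cong (_+ₘ (b +ₘ c)) (⟦toℕ⟧ a) ⟩
    a +ₘ (b +ₘ c)                     ∎
    where open ≡-Reasoning

  +ₘ-identityˡ : ∀ a → 0ₘ +ₘ a ≡ a
  +ₘ-identityˡ a = begin
    0ₘ +ₘ a           ≡⟨ cong (0ₘ +ₘ_) (⟦toℕ⟧ a) ⟨
    ⟦ 0 ⟧ +ₘ ⟦ toℕ a ⟧ ≡⟨ ⟦⟧-homo 0 (toℕ a) ⟨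
    ⟦ toℕ a ⟧          ≡⟨ ⟦toℕ⟧ a ⟩
    a                  ∎
    where open ≡-Reasoning

  -ₘ-inverseˡ : ∀ a → (-ₘ a) +ₘ a ≡ 0ₘ
  -ₘ-inverseˡ a = begin
    (-ₘ a) +ₘ a                ≡⟨ cong ((-ₘ a) +ₘ_) (⟦toℕ⟧ a) ⟨
    ⟦ m ∸ toℕ a ⟧ +ₘ ⟦ toℕ a ⟧ ≡⟨ ⟦⟧-homo (m ∸ toℕ a) (toℕ a) ⟨
    ⟦ m ∸ toℕ a + toℕ a ⟧      ≡⟨ cong ⟦_⟧ (ℕ.m∸n+n≡m (ℕ.<⇒≤ (toℕ<n a))) ⟩
    ⟦ m ⟧                      ≡⟨ ⟦m⟧≡0ₘ ⟩
    0ₘ                         ∎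
    where open ≡-Reasoning

  +ₘ-isAbelianGroup : IsAbelianGroup _≡_ _+ₘ_ 0ₘ -ₘ_
  +ₘ-isAbelianGroup = record
    { isGroup = record
      { isMonoid = record
        { isSemigroup = record
          { isMagma = record { isEquivalence = isEquivalence ; ∙-cong = cong₂ _+ₘ_ }
          ; assoc = +ₘ-assoc
          }
        ; identity = +ₘ-identityˡ , λ a → trans (+ₘ-comm a 0ₘ) (+ₘ-identityˡ a)
        }
      ; inverse = -ₘ-inverseˡ , λ a → trans (+ₘ-comm a (-ₘ a)) (-ₘ-inverseˡ a)
      ; ⁻¹-cong = cong -ₘ_
      }
    ; comm = +ₘ-comm
    }

  inc≡⟦1⟧+ₘ : ∀ a → inc a ≡ ⟦ 1 ⟧ +ₘ a
  inc≡⟦1⟧+ₘ a = trans (⟦⟧-homo 1 (toℕ a)) (cong (⟦ 1 ⟧ +ₘ_) (⟦toℕ⟧ a))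

  ℤₘ : AbelianGroup 0ℓ 0ℓ
  ℤₘ = record { isAbelianGroup = +ₘ-isAbelianGroup }

  ℤₘ^ : ℕ → AbelianGroup 0ℓ 0ℓ
  ℤₘ^ n = record { isAbelianGroup = zipWith-isAbelianGroup +ₘ-isAbelianGroup n }

  module Vecᴳ {n : ℕ} where
    open AbelianGroup (ℤₘ^ n) public
      using (isGroup; monoid; commutativeMonoid; assoc; identityˡ; identityʳ; inverseʳ)
      renaming (_∙_ to _+ᵛ_; ε to 0ᵛ; _-_ to _-ᵛ_)
    open Algebra.Properties.AbelianGroup (ℤₘ^ n) public
    open Algebra.Properties.CommutativeSemigroup (AbelianGroup.commutativeSemigroup (ℤₘ^ n)) public
      using (interchange)
    open AbelianGroupIdentities (ℤₘ^ n) public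
  open Vecᴳ public using (_+ᵛ_; 0ᵛ; _-ᵛ_)

  module ℤₘᴳ where
    open AbelianGroup ℤₘ public using (identityʳ; monoid) renaming (_-_ to _-ₘ_)
    open Algebra.Properties.AbelianGroup ℤₘ public
    open AbelianGroupIdentities ℤₘ public
  open ℤₘᴳ public using (_-ₘ_)

  module ∑ᵛ {n : ℕ} = Algebra.Properties.CommutativeMonoid.Sum (Vecᴳ.commutativeMonoid {n})
  module ∑ₘ = Algebra.Properties.CommutativeMonoid.Sum (AbelianGroup.commutativeMonoid ℤₘ)

  infixr 8 _·_ _•_

  _·_ : Bool → Fin m → Fin m
  true  · a = a
  false · a = 0ₘ

  ·-distrib : ∀ b a a' → b · (a +ₘ a') ≡ b · a +ₘ b · a'
  ·-distrib true  a a' = refl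
  ·-distrib false a a' = sym (+ₘ-identityˡ 0ₘ)

  _•_ : ∀ {v} → Fin m → Subset v → Vec (Fin m) v
  a • p = map (_· a) p

  ·-zeroʳ : ∀ b → b · 0ₘ ≡ 0ₘ
  ·-zeroʳ true  = refl
  ·-zeroʳ false = refl

  0ₘ•≡0ᵛ : ∀ {v} (p : Subset v) → 0ₘ • p ≡ 0ᵛ
  0ₘ•≡0ᵛ p = trans (map-cong ·-zeroʳ p) (map-const p 0ₘ)

  lookup-• : ∀ {v} a (p : Subset v) x → lookup (a • p) x ≡ lookup p x · a
  lookup-• a p x = lookup-map x (_· a) p

  lookup-•-∈ : ∀ {v} a {p : Subset v} {x} → x ∈ p → lookup (a • p) x ≡ a
  lookup-•-∈ a {p} {x} x∈p = trans (lookup-• a p x) (cong (_· a) ([]=⇒lookup x∈p))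

  lookup-•-∉ : ∀ {v} a {p : Subset v} {x} → x ∉ p → lookup (a • p) x ≡ 0ₘ
  lookup-•-∉ a {p} {x} x∉p = trans (lookup-• a p x) (cong (_· a) (¬-not (x∉p ∘ lookup⇒[]= x p)))

  •-distribʳ : ∀ {v} a a' (p : Subset v) → (a +ₘ a') • p ≡ a • p +ᵛ a' • p
  •-distribʳ a a' []      = refl
  •-distribʳ a a' (b ∷ p) = cong₂ _∷_ (·-distrib b a a') (•-distribʳ a a' p)

  lookup-+ᵛ : ∀ {v} (L L' : Vec (Fin m) v) x → lookup (L +ᵛ L') x ≡ lookup L x +ₘ lookup L' x
  lookup-+ᵛ L L' x = lookup-zipWith _+ₘ_ x L L'

  lookup-∑ᵛ : ∀ {v k} (f : Vector (Vec (Fin m) v) k) x →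
    lookup (∑ᵛ.sum f) x ≡ ∑ₘ.sum (λ i → lookup (f i) x)
  lookup-∑ᵛ f x = sum-homo Vecᴳ.monoid (AbelianGroup.monoid ℤₘ) (λ L → lookup L x)
    (λ L L' → lookup-+ᵛ L L' x) (lookup-replicate x 0ₘ) f

  •-split : ∀ {v} a (p q : Subset v) → a • p ≡ a • (p ─ q) +ᵛ a • (p ∩ q)
  •-split a []           []           = refl
  •-split a (true ∷ p)   (true ∷ q)   = cong₂ _∷_ (sym (+ₘ-identityˡ a)) (•-split a p q)
  •-split a (true ∷ p)   (false ∷ q)  = cong₂ _∷_ (sym (ℤₘᴳ.identityʳ a)) (•-split a p q)
  •-split a (false ∷ p)  (true ∷ q)   = cong₂ _∷_ (sym (+ₘ-identityˡ 0ₘ)) (•-split a p q)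
  •-split a (false ∷ p)  (false ∷ q)  = cong₂ _∷_ (sym (+ₘ-identityˡ 0ₘ)) (•-split a p q)

-- Pushes

module _ {m : ℕ} .{{_ : NonZero m}} where

  pushEffect : ∀ {v} (Ss : List (Subset v)) → Vec (Fin m) (length Ss) → Vec (Fin m) v
  pushEffect []       []       = 0ᵛ
  pushEffect (S ∷ Ss) (k ∷ ks) = k • S +ᵛ pushEffect Ss ks

  pushEffect-homo : ∀ {v} (Ss : List (Subset v)) ks ks' →
    pushEffect Ss (ks +ᵛ ks') ≡ pushEffect Ss ks +ᵛ pushEffect Ss ks'
  pushEffect-homo []       []       []         = sym (Vecᴳ.identityˡ 0ᵛ)
  pushEffect-homo (S ∷ Ss) (k ∷ ks) (k' ∷ ks') = begin
    (k +ₘ k') • S +ᵛ pushEffect Ss (ks +ᵛ ks')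
      ≡⟨ cong₂ _+ᵛ_ (•-distribʳ k k' S) (pushEffect-homo Ss ks ks') ⟩
    (k • S +ᵛ k' • S) +ᵛ (pushEffect Ss ks +ᵛ pushEffect Ss ks')
      ≡⟨ Vecᴳ.interchange (k • S) (k' • S) _ _ ⟩
    (k • S +ᵛ pushEffect Ss ks) +ᵛ (k' • S +ᵛ pushEffect Ss ks') ∎
    where open ≡-Reasoning

  push≡⟦1⟧•+ᵛ : ∀ {v} (S : Subset v) (L : Vec (Fin m) v) → push S L ≡ ⟦ 1 ⟧ • S +ᵛ L
  push≡⟦1⟧•+ᵛ []          []      = refl
  push≡⟦1⟧•+ᵛ (true  ∷ S) (a ∷ L) = cong₂ _∷_ (inc≡⟦1⟧+ₘ a) (push≡⟦1⟧•+ᵛ S L)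
  push≡⟦1⟧•+ᵛ (false ∷ S) (a ∷ L) = cong₂ _∷_ (sym (+ₘ-identityˡ a)) (push≡⟦1⟧•+ᵛ S L)

  iter-push : ∀ {v} (S : Subset v) t L → iter (push S) t L ≡ ⟦ t ⟧ • S +ᵛ L
  iter-push S zero    L = sym (trans (cong (_+ᵛ L) (0ₘ•≡0ᵛ S)) (Vecᴳ.identityˡ L))
  iter-push S (suc t) L = begin
    push S (iter (push S) t L)         ≡⟨ cong (push S) (iter-push S t L) ⟩
    push S (⟦ t ⟧ • S +ᵛ L)            ≡⟨ push≡⟦1⟧•+ᵛ S _ ⟩
    ⟦ 1 ⟧ • S +ᵛ (⟦ t ⟧ • S +ᵛ L)      ≡⟨ Vecᴳ.assoc (⟦ 1 ⟧ • S) (⟦ t ⟧ • S) L ⟨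
    (⟦ 1 ⟧ • S +ᵛ ⟦ t ⟧ • S) +ᵛ L      ≡⟨ cong (_+ᵛ L) (•-distribʳ ⟦ 1 ⟧ ⟦ t ⟧ S) ⟨
    (⟦ 1 ⟧ +ₘ ⟦ t ⟧) • S +ᵛ L          ≡⟨ cong (λ a → a • S +ᵛ L) (⟦⟧-homo 1 t) ⟨
    ⟦ suc t ⟧ • S +ᵛ L                 ∎
    where open ≡-Reasoning

  applyPushes≡pushEffect+ᵛ : ∀ {v} (Ss : List (Subset v)) ks (L : Vec (Fin m) v) →
    applyPushes Ss ks L ≡ pushEffect Ss ks +ᵛ L
  applyPushes≡pushEffect+ᵛ []       []       L = sym (Vecᴳ.identityˡ L)
  applyPushes≡pushEffect+ᵛ (S ∷ Ss) (k ∷ ks) L = begin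
    iter (push S) (toℕ k) (applyPushes Ss ks L)
      ≡⟨ iter-push S (toℕ k) _ ⟩
    ⟦ toℕ k ⟧ • S +ᵛ applyPushes Ss ks L
      ≡⟨ cong₂ (λ a L' → a • S +ᵛ L') (⟦toℕ⟧ k) (applyPushes≡pushEffect+ᵛ Ss ks L) ⟩
    k • S +ᵛ (pushEffect Ss ks +ᵛ L)
      ≡⟨ Vecᴳ.assoc (k • S) _ L ⟨
    (k • S +ᵛ pushEffect Ss ks) +ᵛ L ∎
    where open ≡-Reasoning

  module PushEffect {v} (Ss : List (Subset v)) =
    GroupHomomorphism Vecᴳ.isGroup Vecᴳ.isGroup (pushEffect Ss) (pushEffect-homo Ss)

  solutions↔Kernel : ∀ {v} (Ss : List (Subset v)) {L₁ L₂ : Vec (Fin m) v} k₀ →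
    applyPushes Ss k₀ L₁ ≡ L₂ →
    Σ (Vec (Fin m) (length Ss)) (λ ks → applyPushes Ss ks L₁ ≡ L₂) ↔ PushEffect.Kernel Ss
  solutions↔Kernel Ss {L₁} {L₂} k₀ k₀-solves = begin
    Σ _ (λ ks → applyPushes Ss ks L₁ ≡ L₂)
      ↔⟨ Σ-↔ ↔-refl (Irrelevant-⇔⇒↔ uip uip (solves⇒ _) (⇒solves _)) ⟩
    Σ _ (λ ks → pushEffect Ss ks ≡ L₂ -ᵛ L₁)
      ↔⟨ PushEffect.fibre↔Kernel Ss k₀ (solves⇒ k₀ k₀-solves) ⟩
    PushEffect.Kernel Ss ∎
    where
    open Related.EquationalReasoning
    solves⇒ : ∀ ks → applyPushes Ss ks L₁ ≡ L₂ → pushEffect Ss ks ≡ L₂ -ᵛ L₁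
    solves⇒ ks solves = trans (sym (Vecᴳ.//-rightDividesʳ L₁ (pushEffect Ss ks)))
      (cong (_-ᵛ L₁) (trans (sym (applyPushes≡pushEffect+ᵛ Ss ks L₁)) solves))
    ⇒solves : ∀ ks → pushEffect Ss ks ≡ L₂ -ᵛ L₁ → applyPushes Ss ks L₁ ≡ L₂
    ⇒solves ks eq = trans (applyPushes≡pushEffect+ᵛ Ss ks L₁)
      (trans (cong (_+ᵛ L₁) eq) (Vecᴳ.//-rightDividesˡ L₁ L₂))

module _ {m : ℕ} .{{_ : NonZero m}} {v : ℕ} (Ss : List (Subset v)) where
  open PushEffect Ss using (h-identity; h-homo-/)

  Achievable : Vec (Fin m) v → Set
  Achievable L = Σ (Vec (Fin m) (length Ss)) λ ks → pushEffect Ss ks ≡ L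

  achievable-0ᵛ : Achievable 0ᵛ
  achievable-0ᵛ = 0ᵛ , h-identity

  achievable-+ᵛ : ∀ {L L'} → Achievable L → Achievable L' → Achievable (L +ᵛ L')
  achievable-+ᵛ (ks , refl) (ks' , refl) = ks +ᵛ ks' , pushEffect-homo Ss ks ks'

  achievable--ᵛ : ∀ {L L'} → Achievable L → Achievable L' → Achievable (L -ᵛ L')
  achievable--ᵛ (ks , refl) (ks' , refl) = ks -ᵛ ks' , h-homo-/ ks ks'

  achievable-∑ᵛ : ∀ {k} (f : Vector (Vec (Fin m) v) k) → (∀ i → Achievable (f i)) →
    Achievable (∑ᵛ.sum f)
  achievable-∑ᵛ f f-achievable = ∑ᵛ.sum coefficients , (begin
    pushEffect Ss (∑ᵛ.sum coefficients)
      ≡⟨ sum-homo Vecᴳ.monoid Vecᴳ.monoid (pushEffect Ss) (pushEffect-homo Ss) h-identity coefficients ⟩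
    ∑ᵛ.sum (pushEffect Ss ∘ coefficients)
      ≡⟨ ∑ᵛ.sum-cong-≗ (proj₂ ∘ f-achievable) ⟩
    ∑ᵛ.sum f ∎)
    where
    open ≡-Reasoning
    coefficients : Vector (Vec (Fin m) (length Ss)) _
    coefficients = proj₁ ∘ f-achievable

  achievable-• : ∀ {S} → S ∈ˡ Ss → ∀ a → Achievable (a • S)
  achievable-• S∈Ss a = unit S∈Ss , pushEffect-unit S∈Ss
    where
    unit : ∀ {T Ts} → T ∈ˡ Ts → Vec (Fin m) (length Ts)
    unit (here _)     = a ∷ 0ᵛ
    unit (there T∈Ts) = 0ₘ ∷ unit T∈Ts
    pushEffect-unit : ∀ {T Ts} (T∈Ts : T ∈ˡ Ts) → pushEffect Ts (unit T∈Ts) ≡ a • T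
    pushEffect-unit {Ts = T ∷ Ts} (here refl) =
      trans (cong (a • T +ᵛ_) (PushEffect.h-identity Ts)) (Vecᴳ.identityʳ (a • T))
    pushEffect-unit {Ts = T ∷ Ts} (there T∈Ts) =
      trans (cong₂ _+ᵛ_ (0ₘ•≡0ᵛ T) (pushEffect-unit T∈Ts)) (Vecᴳ.identityˡ _)

-- Simplexes and proper colourings

x∈p─q⁻ : ∀ {v} (p q : Subset v) {x} → x ∈ p ─ q → x ∈ p × x ∉ q
x∈p─q⁻ (inside ∷ p)  (outside ∷ q) here          = here , λ ()
x∈p─q⁻ (inside ∷ p)  (inside ∷ q)  {zero} ()
x∈p─q⁻ (outside ∷ p) (inside ∷ q)  {zero} ()
x∈p─q⁻ (outside ∷ p) (outside ∷ q) {zero} ()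
x∈p─q⁻ (_ ∷ p)       (_ ∷ q)       (there x∈p─q) =
  Product.map there (λ x∉q → x∉q ∘ drop-there) (x∈p─q⁻ p q x∈p─q)

injectiveOn⇒∣p∣≤∣q∣ : ∀ {v w} {p : Subset v} {q : Subset w} (f : Fin v → Fin w) →
  (∀ {x} → x ∈ p → f x ∈ q) → (∀ {x y} → x ∈ p → y ∈ p → f x ≡ f y → x ≡ y) →
  ∣ p ∣ ≤ ∣ q ∣
injectiveOn⇒∣p∣≤∣q∣ {p = []} f into injective = z≤n
injectiveOn⇒∣p∣≤∣q∣ {p = outside ∷ p} f into injective =
  injectiveOn⇒∣p∣≤∣q∣ (f ∘ suc) (into ∘ there) λ x∈p y∈p → suc-injective ∘ injective (there x∈p) (there y∈p)
injectiveOn⇒∣p∣≤∣q∣ {p = inside ∷ p} {q} f into injective = ℕ.≤-trans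
  (s≤s (injectiveOn⇒∣p∣≤∣q∣ (f ∘ suc) into-q-f₀ λ x∈p y∈p → suc-injective ∘ injective (there x∈p) (there y∈p)))
  (x∈p⇒∣p-x∣<∣p∣ (into here))
  where
  into-q-f₀ : ∀ {x} → x ∈ p → f (suc x) ∈ q ∖ f zero
  into-q-f₀ x∈p = x∈p∧x≢y⇒x∈p-y (into (there x∈p)) (λ eq → case injective (there x∈p) here eq of λ ())

two-outside⇒2+∣p∩q∣≤∣p∣ : ∀ {v} {p q : Subset v} {x y} → x ≢ y → x ∈ p → y ∈ p → x ∉ q → y ∉ q →
  2 + ∣ p ∩ q ∣ ≤ ∣ p ∣
two-outside⇒2+∣p∩q∣≤∣p∣ {p = p} {q} {x} {y} x≢y x∈p y∈p x∉q y∉q = begin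
  2 + ∣ p ∩ q ∣       ≤⟨ s≤s (s≤s (p⊆q⇒∣p∣≤∣q∣ p∩q⊆p-x-y)) ⟩
  2 + ∣ p ∖ x ∖ y ∣   ≤⟨ s≤s (x∈p⇒∣p-x∣<∣p∣ (x∈p∧x≢y⇒x∈p-y y∈p (x≢y ∘ sym))) ⟩
  1 + ∣ p ∖ x ∣       ≤⟨ x∈p⇒∣p-x∣<∣p∣ x∈p ⟩
  ∣ p ∣               ∎
  where
  open ℕ.≤-Reasoning
  p∩q⊆p-x-y : p ∩ q ⊆ p ∖ x ∖ y
  p∩q⊆p-x-y z∈p∩q with x∈p∩q⁻ p q z∈p∩q
  ... | z∈p , z∈q = x∈p∧x≢y⇒x∈p-y (x∈p∧x≢y⇒x∈p-y z∈p λ { refl → x∉q z∈q }) λ { refl → y∉q z∈q }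

∈-allSubsets : ∀ {v} (S : Subset v) → S ∈ˡ allSubsets v
∈-allSubsets []          = here refl
∈-allSubsets (true ∷ S)  = ∈-++⁺ˡ (∈-map⁺ (true ∷_) (∈-allSubsets S))
∈-allSubsets {suc v} (false ∷ S) =
  ∈-++⁺ʳ (List.map (true ∷_) (allSubsets v)) (∈-map⁺ (false ∷_) (∈-allSubsets S))

module _ {v} (G : Graph v) where
  open Graph G

  properColouring-injectiveOn : ∀ {k n S} (c : Fin v → Fin k) → (∀ x y → Adj x y → c x ≢ c y) →
    IsSimplex G n S → ∀ {x y} → x ∈ S → y ∈ S → c x ≡ c y → x ≡ y
  properColouring-injectiveOn c proper (_ , clique) {x} {y} x∈S y∈S cx≡cy with x ≟ y
  ... | yes x≡y = x≡y
  ... | no x≢y  = ⊥-elim (proper x y (clique x y x∈S y∈S x≢y) cx≡cy)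

  simplex-hasColour : ∀ {n S} (c : Fin v → Fin (suc n)) → (∀ x y → Adj x y → c x ≢ c y) →
    IsSimplex G n S → ∀ i → Σ (Fin v) λ x → x ∈ S × c x ≡ i
  simplex-hasColour {n} {S} c proper S-simplex@(∣S∣≡1+n , _) i
    with any? (λ x → x ∈? S ×-dec c x ≟ i)
  ... | yes hit = hit
  ... | no miss = ⊥-elim (ℕ.<-irrefl refl (begin-strict
    suc n           ≡⟨ ∣S∣≡1+n ⟨
    ∣ S ∣           ≤⟨ injectiveOn⇒∣p∣≤∣q∣ c avoids-i (properColouring-injectiveOn c proper S-simplex) ⟩
    ∣ ⊤ ∖ i ∣       <⟨ x∈p⇒∣p-x∣<∣p∣ (∈⊤ {x = i}) ⟩
    ∣ ⊤ {suc n} ∣   ≡⟨ ∣⊤∣≡n (suc n) ⟩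
    suc n           ∎))
    where
    open ℕ.≤-Reasoning
    avoids-i : ∀ {x} → x ∈ S → c x ∈ ⊤ ∖ i
    avoids-i {x} x∈S = x∈p∧x≢y⇒x∈p-y ∈⊤ (λ cx≡i → miss (x , x∈S , cx≡i))

  AdjSimplex-sym : ∀ {n S S'} → AdjSimplex G n S S' → AdjSimplex G n S' S
  AdjSimplex-sym {S = S} {S'} (S-simplex , S'-simplex , ∣S∩S'∣≡n) =
    S'-simplex , S-simplex , trans (cong ∣_∣ (∩-comm S' S)) ∣S∩S'∣≡n

  adjacent-─≡⁅⁆ : ∀ {n S S'} → AdjSimplex G n S S' → ∀ {y} → y ∈ S → y ∉ S' → S ─ S' ≡ ⁅ y ⁆
  adjacent-─≡⁅⁆ {n} {S} {S'} ((∣S∣≡1+n , _) , _ , ∣S∩S'∣≡n) {y} y∈S y∉S' = ⊆-antisym ─⊆⁅y⁆ ⁅y⁆⊆─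
    where
    ─⊆⁅y⁆ : S ─ S' ⊆ ⁅ y ⁆
    ─⊆⁅y⁆ {x} x∈S─S' with x∈p─q⁻ S S' x∈S─S' | x ≟ y
    ... | _ , _ | yes refl = x∈⁅x⁆ x
    ... | x∈S , x∉S' | no x≢y = ⊥-elim (ℕ.1+n≰n (begin
      2 + n             ≡⟨ cong (2 +_) ∣S∩S'∣≡n ⟨
      2 + ∣ S ∩ S' ∣    ≤⟨ two-outside⇒2+∣p∩q∣≤∣p∣ x≢y x∈S y∈S x∉S' y∉S' ⟩
      ∣ S ∣             ≡⟨ ∣S∣≡1+n ⟩
      1 + n             ∎))
      where open ℕ.≤-Reasoning
    ⁅y⁆⊆─ : ⁅ y ⁆ ⊆ S ─ S'
    ⁅y⁆⊆─ x∈⁅y⁆ rewrite x∈⁅y⁆⇒x≡y y x∈⁅y⁆ = x∈p∧x∉q⇒x∈p─q y∈S y∉S'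

-- Colour sums and the image of the pushes

module ColourSums {m : ℕ} .{{_ : NonZero m}} {v n : ℕ} (G : Graph v) (c : Fin v → Fin (suc n))
  (proper : ∀ x y → Graph.Adj G x y → c x ≢ c y) where

  colourSum : Fin (suc n) → Vec (Fin m) v → Fin m
  colourSum i L = ∑ₘ.sum λ x → does (c x ≟ i) · lookup L x

  colourSum-homo : ∀ i L L' → colourSum i (L +ᵛ L') ≡ colourSum i L +ₘ colourSum i L'
  colourSum-homo i L L' = trans
    (∑ₘ.sum-cong-≗ λ x → trans (cong (does (c x ≟ i) ·_) (lookup-+ᵛ L L' x))
                                (·-distrib (does (c x ≟ i)) (lookup L x) (lookup L' x)))
    (∑ₘ.∑-distrib-+ (λ x → does (c x ≟ i) · lookup L x) (λ x → does (c x ≟ i) · lookup L' x))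

  colourSum-0ᵛ : ∀ i → colourSum i 0ᵛ ≡ 0ₘ
  colourSum-0ᵛ i = sum-vanishing ℤₘᴳ.monoid _
    λ x → trans (cong (does (c x ≟ i) ·_) (lookup-replicate x 0ₘ)) (·-zeroʳ (does (c x ≟ i)))

  colourSum-• : ∀ {S} → IsSimplex G n S → ∀ i a → colourSum i (a • S) ≡ a
  colourSum-• {S} S-simplex i a with simplex-hasColour G c proper S-simplex i
  ... | x₀ , x₀∈S , cx₀≡i = trans (sum-supported ℤₘᴳ.monoid _ x₀ vanishes) at-x₀
    where
    at-x₀ : does (c x₀ ≟ i) · lookup (a • S) x₀ ≡ a
    at-x₀ rewrite dec-true (c x₀ ≟ i) cx₀≡i = lookup-•-∈ a x₀∈S
    vanishes : ∀ x → x ≢ x₀ → does (c x ≟ i) · lookup (a • S) x ≡ 0ₘ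
    vanishes x x≢x₀ with c x ≟ i
    ... | no _     = refl
    ... | yes cx≡i = lookup-•-∉ a λ x∈S →
      x≢x₀ (properColouring-injectiveOn G c proper S-simplex x∈S x₀∈S (trans cx≡i (sym cx₀≡i)))

  colourSum-pushEffect : ∀ {Ss} → All (IsSimplex G n) Ss → ∀ i ks →
    colourSum i (pushEffect Ss ks) ≡ ∑ₘ.sum (lookup ks)
  colourSum-pushEffect []                        i []       = colourSum-0ᵛ i
  colourSum-pushEffect {S ∷ Ss} (S-simplex ∷ simplices) i (k ∷ ks) = trans
    (colourSum-homo i (k • S) (pushEffect Ss ks))
    (cong₂ _+ₘ_ (colourSum-• S-simplex i k) (colourSum-pushEffect simplices i ks))

  Balanced : Vec (Fin m) v → Set
  Balanced L = ∀ i → colourSum i L ≡ colourSum zero L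

  pushEffect-balanced : ∀ {Ss} → All (IsSimplex G n) Ss → ∀ ks → Balanced (pushEffect Ss ks)
  pushEffect-balanced simplices ks i =
    trans (colourSum-pushEffect simplices i ks) (sym (colourSum-pushEffect simplices zero ks))

  imbalance : Vec (Fin m) v → Vec (Fin m) n
  imbalance L = tabulate λ j → colourSum (suc j) L -ₘ colourSum zero L

  imbalance-homo : ∀ L L' → imbalance (L +ᵛ L') ≡ imbalance L +ᵛ imbalance L'
  imbalance-homo L L' = Pointwise-≡⇒≡ (ext λ j → begin
    lookup (imbalance (L +ᵛ L')) j
      ≡⟨ lookup∘tabulate _ j ⟩
    colourSum (suc j) (L +ᵛ L') -ₘ colourSum zero (L +ᵛ L')
      ≡⟨ cong₂ _-ₘ_ (colourSum-homo (suc j) L L') (colourSum-homo zero L L') ⟩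
    (colourSum (suc j) L +ₘ colourSum (suc j) L') -ₘ (colourSum zero L +ₘ colourSum zero L')
      ≡⟨ ℤₘᴳ.-‿interchange (colourSum (suc j) L) (colourSum (suc j) L')
                           (colourSum zero L) (colourSum zero L') ⟩
    (colourSum (suc j) L -ₘ colourSum zero L) +ₘ (colourSum (suc j) L' -ₘ colourSum zero L')
      ≡⟨ cong₂ _+ₘ_ (lookup∘tabulate _ j) (lookup∘tabulate _ j) ⟨
    lookup (imbalance L) j +ₘ lookup (imbalance L') j
      ≡⟨ lookup-+ᵛ (imbalance L) (imbalance L') j ⟨
    lookup (imbalance L +ᵛ imbalance L') j ∎)
    where open ≡-Reasoning

  balanced⇒imbalance≡0ᵛ : ∀ {L} → Balanced L → imbalance L ≡ 0ᵛ
  balanced⇒imbalance≡0ᵛ balanced = Pointwise-≡⇒≡ (ext λ j →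
    trans (lookup∘tabulate _ j) (trans (ℤₘᴳ.x≈y⇒x∙y⁻¹≈ε (balanced (suc j))) (sym (lookup-replicate j 0ₘ))))

  imbalance≡0ᵛ⇒balanced : ∀ {L} → imbalance L ≡ 0ᵛ → Balanced L
  imbalance≡0ᵛ⇒balanced imbalance≡0ᵛ zero    = refl
  imbalance≡0ᵛ⇒balanced imbalance≡0ᵛ (suc j) = ℤₘᴳ.x∙y⁻¹≈ε⇒x≈y _ _ (trans (sym (lookup∘tabulate _ j))
    (trans (cong (λ L → lookup L j) imbalance≡0ᵛ) (lookup-replicate j 0ₘ)))

module PushKernel {m : ℕ} .{{_ : NonZero m}} {v n : ℕ} (G : Graph v) (c : Fin v → Fin (suc n))
  (proper : ∀ x y → Graph.Adj G x y → c x ≢ c y)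
  (simplexGraph : IsSimplexGraph G n) (connected : RegionConnected G n)
  {S₀ : Subset v} (S₀-simplex : IsSimplex G n S₀) where

  open ColourSums {m} G c proper

  Ss : List (Subset v)
  Ss = simplexes G n

  simplices : All (IsSimplex G n) Ss
  simplices = all-filter (isSimplex? G n) (allSubsets v)

  achievable-simplex : ∀ {S} → IsSimplex G n S → ∀ a → Achievable Ss (a • S)
  achievable-simplex {S} S-simplex = achievable-• Ss (∈-filter⁺ (isSimplex? G n) (∈-allSubsets S) S-simplex)

  •-adjacent-difference : ∀ {S S'} → AdjSimplex G n S S' →
    ∀ {y y'} → y ∈ S → y ∉ S' → y' ∈ S' → y' ∉ S → ∀ a →
    a • S -ᵛ a • S' ≡ a • ⁅ y ⁆ -ᵛ a • ⁅ y' ⁆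
  •-adjacent-difference {S} {S'} adj {y} {y'} y∈S y∉S' y'∈S' y'∉S a = begin
    a • S -ᵛ a • S'
      ≡⟨ cong₂ _-ᵛ_ (•-split a S S') (•-split a S' S) ⟩
    (a • (S ─ S') +ᵛ a • (S ∩ S')) -ᵛ (a • (S' ─ S) +ᵛ a • (S' ∩ S))
      ≡⟨ cong₂ (λ p q → (a • p +ᵛ a • (S ∩ S')) -ᵛ (a • q +ᵛ a • (S' ∩ S)))
           (adjacent-─≡⁅⁆ G adj y∈S y∉S') (adjacent-─≡⁅⁆ G (AdjSimplex-sym G adj) y'∈S' y'∉S) ⟩
    (a • ⁅ y ⁆ +ᵛ a • (S ∩ S')) -ᵛ (a • ⁅ y' ⁆ +ᵛ a • (S' ∩ S))
      ≡⟨ cong (λ p → (a • ⁅ y ⁆ +ᵛ a • (S ∩ S')) -ᵛ (a • ⁅ y' ⁆ +ᵛ a • p)) (∩-comm S' S) ⟩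
    (a • ⁅ y ⁆ +ᵛ a • (S ∩ S')) -ᵛ (a • ⁅ y' ⁆ +ᵛ a • (S ∩ S'))
      ≡⟨ Vecᴳ.-‿cancelʳ (a • ⁅ y ⁆) (a • ⁅ y' ⁆) (a • (S ∩ S')) ⟩
    a • ⁅ y ⁆ -ᵛ a • ⁅ y' ⁆ ∎
    where open ≡-Reasoning

  base : Fin (suc n) → Fin v
  base i = proj₁ (simplex-hasColour G c proper S₀-simplex i)

  base-∈ : ∀ i → base i ∈ S₀
  base-∈ i = proj₁ (proj₂ (simplex-hasColour G c proper S₀-simplex i))

  c∘base : ∀ i → c (base i) ≡ i
  c∘base i = proj₂ (proj₂ (simplex-hasColour G c proper S₀-simplex i))

  base∘c : ∀ {x} → x ∈ S₀ → base (c x) ≡ x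
  base∘c {x} x∈S₀ = properColouring-injectiveOn G c proper S₀-simplex (base-∈ (c x)) x∈S₀ (c∘base (c x))

  achievable-transfer-along : ∀ {S} → Star (AdjSimplex G n) S S₀ → IsSimplex G n S → ∀ {y} → y ∈ S → ∀ a →
    Achievable Ss (a • ⁅ y ⁆ -ᵛ a • ⁅ base (c y) ⁆)
  achievable-transfer-along Star.ε _ {y} y∈S₀ a rewrite base∘c y∈S₀ =
    subst (Achievable Ss) (sym (Vecᴳ.inverseʳ (a • ⁅ y ⁆))) (achievable-0ᵛ Ss)
  achievable-transfer-along {S} (_◅_ {j = S'} adj path) S-simplex {y} y∈S a
    with simplex-hasColour G c proper (proj₁ (proj₂ adj)) (c y)
  ... | y' , y'∈S' , cy'≡cy with y ≟ y'
  ...   | yes refl = achievable-transfer-along path (proj₁ (proj₂ adj)) y'∈S' a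
  ...   | no y≢y' = subst (Achievable Ss) telescope
    (achievable-+ᵛ Ss
      (subst (Achievable Ss) (•-adjacent-difference adj y∈S y∉S' y'∈S' y'∉S a)
        (achievable--ᵛ Ss (achievable-simplex S-simplex a) (achievable-simplex S'-simplex a)))
      (achievable-transfer-along path S'-simplex y'∈S' a))
    where
    S'-simplex : IsSimplex G n S'
    S'-simplex = proj₁ (proj₂ adj)
    y∉S' : y ∉ S'
    y∉S' y∈S' = y≢y' (properColouring-injectiveOn G c proper S'-simplex y∈S' y'∈S' (sym cy'≡cy))
    y'∉S : y' ∉ S
    y'∉S y'∈S = y≢y' (properColouring-injectiveOn G c proper S-simplex y∈S y'∈S (sym cy'≡cy))
    telescope : (a • ⁅ y ⁆ -ᵛ a • ⁅ y' ⁆) +ᵛ (a • ⁅ y' ⁆ -ᵛ a • ⁅ base (c y') ⁆) ≡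
                a • ⁅ y ⁆ -ᵛ a • ⁅ base (c y) ⁆
    telescope rewrite cy'≡cy = Vecᴳ.-‿telescope (a • ⁅ y ⁆) (a • ⁅ y' ⁆) (a • ⁅ base (c y) ⁆)

  achievable-transfer-vertex : ∀ x a → Achievable Ss (a • ⁅ x ⁆ -ᵛ a • ⁅ base (c x) ⁆)
  achievable-transfer-vertex x with proj₁ simplexGraph x
  ... | S , S-simplex , x∈S = achievable-transfer-along (connected S S₀ S-simplex S₀-simplex) S-simplex x∈S

  ∑-point-masses : ∀ (L : Vec (Fin m) v) → ∑ᵛ.sum (λ x → lookup L x • ⁅ x ⁆) ≡ L
  ∑-point-masses L = Pointwise-≡⇒≡ (ext λ z → begin
    lookup (∑ᵛ.sum (λ x → lookup L x • ⁅ x ⁆)) z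
      ≡⟨ lookup-∑ᵛ (λ x → lookup L x • ⁅ x ⁆) z ⟩
    ∑ₘ.sum (λ x → lookup (lookup L x • ⁅ x ⁆) z)
      ≡⟨ sum-supported ℤₘᴳ.monoid _ z (λ x x≢z → lookup-•-∉ (lookup L x) (x≢z ∘ sym ∘ x∈⁅y⁆⇒x≡y x)) ⟩
    lookup (lookup L z • ⁅ z ⁆) z
      ≡⟨ lookup-•-∈ (lookup L z) (x∈⁅x⁆ z) ⟩
    lookup L z ∎)
    where open ≡-Reasoning

  ∑-base-masses : ∀ {L : Vec (Fin m) v} → Balanced L →
    ∑ᵛ.sum (λ x → lookup L x • ⁅ base (c x) ⁆) ≡ colourSum zero L • S₀
  ∑-base-masses {L} balanced = Pointwise-≡⇒≡ (ext λ z →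
    trans (lookup-∑ᵛ (λ x → lookup L x • ⁅ base (c x) ⁆) z) (at z (z ∈? S₀)))
    where
    open ≡-Reasoning
    at : ∀ z → Dec (z ∈ S₀) →
      ∑ₘ.sum (λ x → lookup (lookup L x • ⁅ base (c x) ⁆) z) ≡ lookup (colourSum zero L • S₀) z
    at z (yes z∈S₀) = begin
      ∑ₘ.sum (λ x → lookup (lookup L x • ⁅ base (c x) ⁆) z)   ≡⟨ ∑ₘ.sum-cong-≗ term ⟩
      colourSum (c z) L                                        ≡⟨ balanced (c z) ⟩
      colourSum zero L                                         ≡⟨ lookup-•-∈ _ z∈S₀ ⟨
      lookup (colourSum zero L • S₀) z                         ∎
      where
      term : ∀ x → lookup (lookup L x • ⁅ base (c x) ⁆) z ≡ does (c x ≟ c z) · lookup L x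
      term x with c x ≟ c z
      ... | yes cx≡cz = lookup-•-∈ _
        (subst (_∈ ⁅ base (c x) ⁆) (trans (cong base cx≡cz) (base∘c z∈S₀)) (x∈⁅x⁆ _))
      ... | no cx≢cz  = lookup-•-∉ _ λ z∈⁅base⁆ →
        cx≢cz (trans (sym (c∘base (c x))) (cong c (sym (x∈⁅y⁆⇒x≡y _ z∈⁅base⁆))))
    at z (no z∉S₀) = trans
      (sum-vanishing ℤₘᴳ.monoid _ λ x → lookup-•-∉ _ λ z∈⁅base⁆ →
        z∉S₀ (subst (_∈ S₀) (sym (x∈⁅y⁆⇒x≡y _ z∈⁅base⁆)) (base-∈ (c x))))
      (sym (lookup-•-∉ _ z∉S₀))

  balanced⇒achievable : ∀ {L : Vec (Fin m) v} → Balanced L → Achievable Ss L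
  balanced⇒achievable {L} balanced = subst (Achievable Ss) decomposition
    (achievable-+ᵛ Ss
      (achievable-∑ᵛ Ss (λ x → point x -ᵛ based x) λ x → achievable-transfer-vertex x (lookup L x))
      (achievable-simplex S₀-simplex (colourSum zero L)))
    where
    open ≡-Reasoning
    point based : Fin v → Vec (Fin m) v
    point x = lookup L x • ⁅ x ⁆
    based x = lookup L x • ⁅ base (c x) ⁆
    decomposition : ∑ᵛ.sum (λ x → point x -ᵛ based x) +ᵛ colourSum zero L • S₀ ≡ L
    decomposition = begin
      ∑ᵛ.sum (λ x → point x -ᵛ based x) +ᵛ colourSum zero L • S₀
        ≡⟨ cong (∑ᵛ.sum (λ x → point x -ᵛ based x) +ᵛ_) (∑-base-masses {L} balanced) ⟨
      ∑ᵛ.sum (λ x → point x -ᵛ based x) +ᵛ ∑ᵛ.sum based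
        ≡⟨ ∑ᵛ.∑-distrib-+ (λ x → point x -ᵛ based x) based ⟨
      ∑ᵛ.sum (λ x → (point x -ᵛ based x) +ᵛ based x)
        ≡⟨ ∑ᵛ.sum-cong-≗ (λ x → Vecᴳ.//-rightDividesˡ (based x) (point x)) ⟩
      ∑ᵛ.sum point
        ≡⟨ ∑-point-masses L ⟩
      L ∎

  baseLabeling : Vec (Fin m) n → Vec (Fin m) v
  baseLabeling z = tabulate λ x → does (x ∈? S₀) · lookup (0ₘ ∷ z) (c x)

  colourSum-baseLabeling : ∀ z i → colourSum i (baseLabeling z) ≡ lookup (0ₘ ∷ z) i
  colourSum-baseLabeling z i = trans (sum-supported ℤₘᴳ.monoid _ (base i) vanishes) at-base
    where
    at-base : does (c (base i) ≟ i) · lookup (baseLabeling z) (base i) ≡ lookup (0ₘ ∷ z) i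
    at-base rewrite lookup∘tabulate (λ x → does (x ∈? S₀) · lookup (0ₘ ∷ z) (c x)) (base i)
                  | dec-true (c (base i) ≟ i) (c∘base i)
                  | dec-true (base i ∈? S₀) (base-∈ i)
                  | c∘base i = refl
    vanishes : ∀ x → x ≢ base i → does (c x ≟ i) · lookup (baseLabeling z) x ≡ 0ₘ
    vanishes x x≢base rewrite lookup∘tabulate (λ x → does (x ∈? S₀) · lookup (0ₘ ∷ z) (c x)) x
      with c x ≟ i | x ∈? S₀
    ... | no _     | _         = refl
    ... | yes _    | no _      = refl
    ... | yes refl | yes x∈S₀  = ⊥-elim (x≢base (sym (base∘c x∈S₀)))

  imbalance-baseLabeling : ∀ z → imbalance (baseLabeling z) ≡ z
  imbalance-baseLabeling z = Pointwise-≡⇒≡ (ext λ j → begin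
    lookup (imbalance (baseLabeling z)) j
      ≡⟨ lookup∘tabulate _ j ⟩
    colourSum (suc j) (baseLabeling z) -ₘ colourSum zero (baseLabeling z)
      ≡⟨ cong₂ _-ₘ_ (colourSum-baseLabeling z (suc j)) (colourSum-baseLabeling z zero) ⟩
    lookup z j -ₘ 0ₘ
      ≡⟨ cong (lookup z j +ₘ_) ℤₘᴳ.ε⁻¹≈ε ⟩
    lookup z j +ₘ 0ₘ
      ≡⟨ ℤₘᴳ.identityʳ (lookup z j) ⟩
    lookup z j ∎)
    where open ≡-Reasoning

  module Imbalance = GroupHomomorphism Vecᴳ.isGroup Vecᴳ.isGroup imbalance imbalance-homo

  pushes↔Kernel×balanced : Vec (Fin m) (length Ss) ↔ (PushEffect.Kernel Ss × Imbalance.Kernel)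
  pushes↔Kernel×balanced = PushEffect.↔Kernel×image Ss (λ L → imbalance L ≡ 0ᵛ) (λ _ → uip)
    (λ ks → balanced⇒imbalance≡0ᵛ {pushEffect Ss ks} (pushEffect-balanced simplices ks))
    (λ L → balanced⇒achievable {L} ∘ imbalance≡0ᵛ⇒balanced {L})

  labelings↔balanced×offsets : Vec (Fin m) v ↔ (Imbalance.Kernel × Vec (Fin m) n)
  labelings↔balanced×offsets = ↔-trans
    (Imbalance.↔Kernel×image (λ _ → Unit.⊤) (λ _ _ _ → refl) (λ _ → Unit.tt)
      (λ z _ → baseLabeling z , imbalance-baseLabeling z))
    (mk↔ₛ′ (Product.map₂ proj₁) (Product.map₂ (_, Unit.tt)) (λ _ → refl) (λ _ → refl))

  kernel↔Fin : 1 < m → PushEffect.Kernel Ss ↔ Fin (m ^ (length Ss + n ∸ v))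
  kernel↔Fin 1<m = subst (λ k → PushEffect.Kernel Ss ↔ Fin k)
    (^-cancel {m} {length Ss} {v} {n} 1<m κ≢0 m^R≡κw m^v≡wm^n) kernel↔Fin-κ
    where
    open Related.EquationalReasoning
    kernel-finite : Σ ℕ λ k → PushEffect.Kernel Ss ↔ Fin k
    kernel-finite = Σ-finite (Vec↔Fin^ m (length Ss)) (λ _ → uip) (λ ks → ≡-dec _≟_ (pushEffect Ss ks) 0ᵛ)
    balanced-finite : Σ ℕ λ k → Imbalance.Kernel ↔ Fin k
    balanced-finite = Σ-finite (Vec↔Fin^ m v) (λ _ → uip) (λ L → ≡-dec _≟_ (imbalance L) 0ᵛ)
    κ w : ℕ
    κ = proj₁ kernel-finite
    w = proj₁ balanced-finite
    kernel↔Fin-κ : PushEffect.Kernel Ss ↔ Fin κ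
    kernel↔Fin-κ = proj₂ kernel-finite
    κ≢0 : NonZero κ
    κ≢0 = nonZeroIndex (Inverse.to kernel↔Fin-κ (0ᵛ , PushEffect.h-identity Ss))
    m^R≡κw : m ^ length Ss ≡ κ * w
    m^R≡κw = ↔⇒≡ (begin
      Fin (m ^ length Ss)                          ↔⟨ Vec↔Fin^ m (length Ss) ⟨
      Vec (Fin m) (length Ss)                      ↔⟨ pushes↔Kernel×balanced ⟩
      (PushEffect.Kernel Ss × Imbalance.Kernel)    ↔⟨ kernel↔Fin-κ ×-↔ proj₂ balanced-finite ⟩
      (Fin κ × Fin w)                              ↔⟨ *↔× ⟨
      Fin (κ * w)                                  ∎)
    m^v≡wm^n : m ^ v ≡ w * m ^ n
    m^v≡wm^n = ↔⇒≡ (begin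
      Fin (m ^ v)                                  ↔⟨ Vec↔Fin^ m v ⟨
      Vec (Fin m) v                                ↔⟨ labelings↔balanced×offsets ⟩
      (Imbalance.Kernel × Vec (Fin m) n)           ↔⟨ proj₂ balanced-finite ×-↔ Vec↔Fin^ m n ⟩
      (Fin w × Fin (m ^ n))                        ↔⟨ *↔× ⟨
      Fin (w * m ^ n)                              ∎)

¬Colourable⇒vertex : ∀ {v k} (G : Graph v) → ¬ Colourable G k → Fin v
¬Colourable⇒vertex {zero}  G not-colourable = ⊥-elim (not-colourable ((λ ()) , λ ()))
¬Colourable⇒vertex {suc v} G not-colourable = zero

theorem4p6p10 : (n m v : ℕ) .{{_ : NonZero m}} → 1 ≤ n → 2 ≤ m →
    (G : Graph v) → IsSimplexGraph G n → RegionConnected G n →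
    ChromaticNumber G (suc n) →
    (L₁ L₂ : Labeling v m) → Solution G n m L₁ L₂ →
    Solution G n m L₁ L₂ ↔ Fin (m ^ (length (simplexes G n) + n ∸ v))
theorem4p6p10 n m v _ 2≤m G simplexGraph connected ((c , proper) , not-colourable) L₁ L₂
  (k₀ , k₀-solves) =
  ↔-trans (solutions↔Kernel (simplexes G n) k₀ k₀-solves) (Kernel.kernel↔Fin 2≤m)
  where
  S₀-simplex : IsSimplex G n (proj₁ (proj₁ simplexGraph (¬Colourable⇒vertex G not-colourable)))
  S₀-simplex = proj₁ (proj₂ (proj₁ simplexGraph (¬Colourable⇒vertex G not-colourable)))
  module Kernel = PushKernel G c proper simplexGraph connected S₀-simplex
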